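{- Let $D=1$ and $1\le A<2$. Let $n$ be a positive integer and let $N=n_\lambda\dots n_0$ be its non-adjacent form. Then $\delta(N,i)\le A$ for all $0\le i\le\lambda$, and moreover $\delta(N,i)\le A-1$ whenever $n_i=0$.
   Context: The non-adjacent form (NAF) of a positive integer $n$ is the (unique) string $n_\lambda\dots n_0$ with $n_i\in\{ -1,0,1\}$, $\sum_i n_i2^i=n$, and no two adjacent digits both nonzero. Time model with doubling time $D$ and addition time $A$: for a digit string $N=n_\lambda\dots n_0$, define recursively for $0\le i\le\lambda$: $T(N,i)=0$ if $i=0$ and $n_0=0$; $T(N,i)=T(N,i-1)$ if $i>0$ and $n_i=0$; $T(N,i)=iD+(|n_i|-1)A$ if $n_i\ne0$ and $n_j=0$ for all $0\le j<i$; and $T(N,i)=\max(T(N,i-1),iD)+|n_i|A$ otherwise. With $D=1$, the delay is $\delta(N,i)=T(N,i)-i$.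
   Formalization: The addition time A takes rational values rather than real values. -}

module Defs where

open import Data.Nat using (ℕ; zero; suc)
open import Data.Integer as ℤ using (ℤ; +_; -[1+_])
open import Data.Rational as ℚ using (ℚ; _/_; _+_; _*_; _-_; _⊔_; 0ℚ; 1ℚ)
open import Data.List using (List; []; _∷_; _++_; [_])
open import Data.Bool using (Bool; true; false; if_then_else_; _∧_)
open import Data.Product using (Σ; _×_; ∃₂)
open import Data.Sum using (_⊎_)
open import Relation.Binary.PropositionalEquality using (_≡_; _≢_)
open import Data.Unit using (⊤)

data Digit : Set where
  𝟎 𝟏 𝟏̄ : Digit

digitℤ : Digit → ℤ
digitℤ 𝟎 = + 0
digitℤ 𝟏 = + 1
digitℤ 𝟏̄ = -[1+ 0 ]

absDigit : Digit → ℕ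
absDigit 𝟎 = 0
absDigit 𝟏 = 1
absDigit 𝟏̄ = 1

isZero : Digit → Bool
isZero 𝟎 = true
isZero 𝟏 = false
isZero 𝟏̄ = false

-- A digit string N = n_λ … n_0 is represented as the list  n_0 ∷ n_1 ∷ … ∷ n_λ ∷ []
-- (least significant digit first); λ = length N - 1.
DigitString : Set
DigitString = List Digit

value : DigitString → ℤ
value [] = + 0
value (d ∷ ds) = digitℤ d ℤ.+ (+ 2) ℤ.* value ds

NonAdjacent : DigitString → Set
NonAdjacent [] = ⊤
NonAdjacent (d ∷ []) = ⊤
NonAdjacent (d ∷ e ∷ ds) = (d ≡ 𝟎 ⊎ e ≡ 𝟎) × NonAdjacent (e ∷ ds)

IsNAF : DigitString → ℕ → Set
IsNAF N n = (value N ≡ + n) × NonAdjacent N × ∃₂ (λ ds d → (N ≡ ds ++ [ d ]) × (d ≢ 𝟎))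

-- n_i (digits beyond λ are 0)
digit : DigitString → ℕ → Digit
digit [] i = 𝟎
digit (d ∷ ds) zero = d
digit (d ∷ ds) (suc i) = digit ds i

allZeroBelow : DigitString → ℕ → Bool
allZeroBelow N zero = true
allZeroBelow N (suc i) = allZeroBelow N i ∧ isZero (digit N i)

ℕ→ℚ : ℕ → ℚ
ℕ→ℚ k = (+ k) / 1

-- T(N,i) with doubling time D and addition time A
T : (D A : ℚ) → DigitString → ℕ → ℚ
T D A N i with isZero (digit N i)
T D A N zero | true = 0ℚ
T D A N (suc i) | true = T D A N i
T D A N zero | false = ℕ→ℚ 0 * D + (ℕ→ℚ (absDigit (digit N 0)) - 1ℚ) * A
T D A N (suc i) | false =
  if allZeroBelow N (suc i)
  then ℕ→ℚ (suc i) * D + (ℕ→ℚ (absDigit (digit N (suc i))) - 1ℚ) * A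
  else (T D A N i ⊔ ℕ→ℚ (suc i) * D) + ℕ→ℚ (absDigit (digit N (suc i))) * A

δ : (A : ℚ) → DigitString → ℕ → ℚ
δ A N i = T 1ℚ A N i - ℕ→ℚ i

-- The delay can only grow at a nonzero digit, where it becomes at most A, because
-- the previous digit is zero and (inductively) its delay is at most A - 1 ≤ 1: the
-- running sum is then ready no later than the doubling, so the addition finishes
-- by time (i + 1) + A. At a zero digit T stands still while i grows by one, so the
-- delay drops from at most A to at most A - 1.
module Submission where

open import Defs
open import Data.Bool using (true; false; if_then_else_)
open import Data.Empty using (⊥-elim)
open import Data.Integer as ℤ using (+_; 1ℤ)
open import Data.Integer.Tactic.RingSolver using (solve-∀)
open import Data.List using (length; []; _∷_)
open import Data.Nat using (ℕ; _<_; zero; suc)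
open import Data.Product using (_×_; _,_)
open import Data.Rational using (ℚ; _≤_; _-_; _+_; _*_; _⊔_; -_; 0ℚ; 1ℚ; toℚᵘ)
  renaming (_<_ to _<ℚ_)
open import Data.Rational.Properties
open import Data.Rational.Solver using (module +-*-Solver)
open import Data.Rational.Unnormalised as ℚᵘ using (mkℚᵘ; *≡*; 1ℚᵘ)
import Data.Rational.Unnormalised.Properties as ℚᵘ
open import Data.Sum using (inj₁; inj₂)
open import Relation.Binary.PropositionalEquality using (_≡_; _≢_; refl; sym; cong; cong₂; subst; module ≡-Reasoning)

isZero≡false⇒≢𝟎 : ∀ {d} → isZero d ≡ false → d ≢ 𝟎
isZero≡false⇒≢𝟎 () refl

isZero≡false⇒absDigit≡1 : ∀ {d} → isZero d ≡ false → absDigit d ≡ 1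
isZero≡false⇒absDigit≡1 {𝟏} _ = refl
isZero≡false⇒absDigit≡1 {𝟏̄} _ = refl

nonAdjacent-digit : ∀ {N} → NonAdjacent N → ∀ i → digit N (suc i) ≢ 𝟎 → digit N i ≡ 𝟎
nonAdjacent-digit {[]}        _              i       nᵢ₊₁≢𝟎 = ⊥-elim (nᵢ₊₁≢𝟎 refl)
nonAdjacent-digit {_ ∷ []}    _              i       nᵢ₊₁≢𝟎 = ⊥-elim (nᵢ₊₁≢𝟎 refl)
nonAdjacent-digit {_ ∷ _ ∷ _} (inj₁ d≡𝟎 , _) zero    _      = d≡𝟎
nonAdjacent-digit {_ ∷ _ ∷ _} (inj₂ e≡𝟎 , _) zero    nᵢ₊₁≢𝟎 = ⊥-elim (nᵢ₊₁≢𝟎 e≡𝟎)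
nonAdjacent-digit {_ ∷ _ ∷ _} (_ , na)       (suc i) nᵢ₊₁≢𝟎 = nonAdjacent-digit na i nᵢ₊₁≢𝟎

ℕ→ℚ-suc : ∀ k → ℕ→ℚ (suc k) ≡ ℕ→ℚ k + 1ℚ
ℕ→ℚ-suc k = toℚᵘ-injective (begin
  toℚᵘ (ℕ→ℚ (suc k))       ≈⟨ toℚᵘ-fromℚᵘ (mkℚᵘ (+ suc k) 0) ⟩
  mkℚᵘ (+ suc k) 0          ≈⟨ *≡* (cross-multiplied (+ k)) ⟩
  mkℚᵘ (+ k) 0 ℚᵘ.+ 1ℚᵘ     ≈⟨ ℚᵘ.+-congˡ 1ℚᵘ (ℚᵘ.≃-sym (toℚᵘ-fromℚᵘ (mkℚᵘ (+ k) 0))) ⟩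
  toℚᵘ (ℕ→ℚ k) ℚᵘ.+ toℚᵘ 1ℚ ≈⟨ ℚᵘ.≃-sym (toℚᵘ-homo-+ (ℕ→ℚ k) 1ℚ) ⟩
  toℚᵘ (ℕ→ℚ k + 1ℚ)        ∎)
  where
  open ℚᵘ.≃-Reasoning
  cross-multiplied : ∀ x → (1ℤ ℤ.+ x) ℤ.* 1ℤ ≡ (x ℤ.* 1ℤ ℤ.+ 1ℤ ℤ.* 1ℤ) ℤ.* 1ℤ
  cross-multiplied = solve-∀

p≤p+q : ∀ p {q} → 0ℚ ≤ q → p ≤ p + q
p≤p+q p {q} 0≤q = subst (_≤ p + q) (+-identityʳ p) (+-monoʳ-≤ p 0≤q)

p≤q+r⇒p-q≤r : ∀ {p} q {r} → p ≤ q + r → p - q ≤ r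
p≤q+r⇒p-q≤r {p} q {r} p≤q+r = subst (p - q ≤_) (q+r-q≡r q r) (+-monoˡ-≤ (- q) p≤q+r)
  where
  open +-*-Solver
  q+r-q≡r : ∀ q r → (q + r) - q ≡ r
  q+r-q≡r = solve 2 (λ q r → (q :+ r) :+ :- q := r) refl

p-1≤p : ∀ p → p - 1ℚ ≤ p
p-1≤p p = subst (p - 1ℚ ≤_) (p-1+1≡p p) (p≤p+q (p - 1ℚ) (≤ᵇ⇒≤ _))
  where
  open +-*-Solver
  p-1+1≡p : ∀ p → (p - 1ℚ) + 1ℚ ≡ p
  p-1+1≡p = solve 1 (λ p → (p :- con 1ℚ) :+ con 1ℚ := p) refl

delayBound : ℚ → Digit → ℚ
delayBound A d = if isZero d then A - 1ℚ else A

delayBound≤A : ∀ A d → delayBound A d ≤ A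
delayBound≤A A 𝟎 = p-1≤p A
delayBound≤A A 𝟏 = ≤-refl
delayBound≤A A 𝟏̄ = ≤-refl

-- The right-hand sides of the two nonzero-digit clauses of T (first nonzero digit,
-- later digit), with D = 1.
firstAddition-≤ : ∀ {A} x {d} → 0ℚ ≤ A → isZero d ≡ false →
                  x * 1ℚ + (ℕ→ℚ (absDigit d) - 1ℚ) * A ≤ x + A
firstAddition-≤ {A} x 0≤A d≢𝟎 rewrite isZero≡false⇒absDigit≡1 d≢𝟎 =
  subst (_≤ x + A) (x≡x*1+[1-1]*A x A) (p≤p+q x 0≤A)
  where
  open +-*-Solver
  x≡x*1+[1-1]*A : ∀ x A → x ≡ x * 1ℚ + (1ℚ - 1ℚ) * A
  x≡x*1+[1-1]*A = solve 2 (λ x A → x := x :* con 1ℚ :+ (con 1ℚ :- con 1ℚ) :* A) refl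

laterAddition-≡ : ∀ {A t} x {d} → isZero d ≡ false → t ≤ x →
                  (t ⊔ x * 1ℚ) + ℕ→ℚ (absDigit d) * A ≡ x + A
laterAddition-≡ {A} {t} x d≢𝟎 t≤x rewrite isZero≡false⇒absDigit≡1 d≢𝟎 = begin
  (t ⊔ x * 1ℚ) + 1ℚ * A ≡⟨ cong (λ y → (t ⊔ y) + 1ℚ * A) (*-identityʳ x) ⟩
  (t ⊔ x) + 1ℚ * A      ≡⟨ cong₂ _+_ (p≤q⇒p⊔q≡q t≤x) (*-identityˡ A) ⟩
  x + A                 ∎
  where open ≡-Reasoning

module _ {A : ℚ} (1≤A : 1ℚ ≤ A) (A≤2 : A ≤ 1ℚ + 1ℚ) where

  private
    0≤A-1 : 0ℚ ≤ A - 1ℚ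
    0≤A-1 = subst (_≤ A - 1ℚ) (+-inverseʳ 1ℚ) (+-monoˡ-≤ (- 1ℚ) 1≤A)

    0≤A : 0ℚ ≤ A
    0≤A = ≤-trans 0≤A-1 (p-1≤p A)

    A-1≤1 : A - 1ℚ ≤ 1ℚ
    A-1≤1 = p≤q+r⇒p-q≤r 1ℚ A≤2

  T≤i+delayBound : ∀ {N} → NonAdjacent N → ∀ i → T 1ℚ A N i ≤ ℕ→ℚ i + delayBound A (digit N i)
  T≤i+delayBound {N} _ zero with isZero (digit N 0) in n₀
  ... | true  = subst (0ℚ ≤_) (sym (+-identityˡ (A - 1ℚ))) 0≤A-1
  ... | false = firstAddition-≤ 0ℚ 0≤A n₀
  T≤i+delayBound {N} na (suc i) with isZero (digit N (suc i)) in nᵢ₊₁ | T≤i+delayBound na i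
  ... | true  | Tᵢ≤ = begin
    T 1ℚ A N i                           ≤⟨ Tᵢ≤ ⟩
    ℕ→ℚ i + delayBound A (digit N i)     ≤⟨ +-monoʳ-≤ (ℕ→ℚ i) (delayBound≤A A (digit N i)) ⟩
    ℕ→ℚ i + A                            ≡⟨ p+q≡[p+1]+[q-1] (ℕ→ℚ i) A ⟩
    (ℕ→ℚ i + 1ℚ) + (A - 1ℚ)              ≡⟨ cong (_+ (A - 1ℚ)) (sym (ℕ→ℚ-suc i)) ⟩
    ℕ→ℚ (suc i) + (A - 1ℚ)               ∎
    where
    open ≤-Reasoning
    open +-*-Solver
    p+q≡[p+1]+[q-1] : ∀ p q → p + q ≡ (p + 1ℚ) + (q - 1ℚ)
    p+q≡[p+1]+[q-1] = solve 2 (λ p q → p :+ q := (p :+ con 1ℚ) :+ (q :- con 1ℚ)) refl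
  ... | false | Tᵢ≤ with allZeroBelow N (suc i)
  ...   | true  = firstAddition-≤ (ℕ→ℚ (suc i)) 0≤A nᵢ₊₁
  ...   | false = ≤-reflexive (laterAddition-≡ (ℕ→ℚ (suc i)) nᵢ₊₁ Tᵢ≤i+1)
    where
    open ≤-Reasoning
    nᵢ≡𝟎 : digit N i ≡ 𝟎
    nᵢ≡𝟎 = nonAdjacent-digit na i (isZero≡false⇒≢𝟎 nᵢ₊₁)
    Tᵢ≤i+1 : T 1ℚ A N i ≤ ℕ→ℚ (suc i)
    Tᵢ≤i+1 = begin
      T 1ℚ A N i                        ≤⟨ Tᵢ≤ ⟩
      ℕ→ℚ i + delayBound A (digit N i)  ≡⟨ cong (λ d → ℕ→ℚ i + delayBound A d) nᵢ≡𝟎 ⟩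
      ℕ→ℚ i + (A - 1ℚ)                  ≤⟨ +-monoʳ-≤ (ℕ→ℚ i) A-1≤1 ⟩
      ℕ→ℚ i + 1ℚ                        ≡⟨ sym (ℕ→ℚ-suc i) ⟩
      ℕ→ℚ (suc i)                       ∎

proposition2 : (A : ℚ) → 1ℚ ≤ A → A <ℚ (1ℚ Data.Rational.+ 1ℚ) →
    (n : ℕ) → 0 < n → (N : DigitString) → IsNAF N n →
    (i : ℕ) → i < length N →
      (δ A N i ≤ A) × (digit N i ≡ 𝟎 → δ A N i ≤ A - 1ℚ)
proposition2 A 1≤A A<2 _ _ N (_ , nonAdjacent , _) i _ =
  ≤-trans δ≤delayBound (delayBound≤A A (digit N i)) ,
  λ nᵢ≡𝟎 → subst (λ d → δ A N i ≤ delayBound A d) nᵢ≡𝟎 δ≤delayBound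
  where
  δ≤delayBound : δ A N i ≤ delayBound A (digit N i)
  δ≤delayBound = p≤q+r⇒p-q≤r (ℕ→ℚ i) (T≤i+delayBound 1≤A (<⇒≤ A<2) nonAdjacent i)
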